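{- Let $\mu$ be a $p$-symmetric fuzzy measure on the finite set $X$ with respect to the partition $\{A_1,\dots,A_p\}$, with $a_i=|A_i|$, Möbius transform $m$ and Shapley interaction index $I$. Then for every $B\subset X$ with profile $(b_1,\dots,b_p)$, $$ I(B)=\sum_{c_1\ge b_1,\dots,c_p\ge b_p}\frac{1}{c-b+1}\binom{a_1-b_1}{c_1-b_1}\cdots\binom{a_p-b_p}{c_p-b_p}\, m(c_1,\dots,c_p),$$ where the sum runs over integers $b_k\le c_k\le a_k$, and $c=\sum_i c_i$, $b=\sum_i b_i$.
   Context: A fuzzy measure on a finite set $X$ ($|X|=n$) is a set function $\mu:\mathcal P(X)\to[0,1]$ with $\mu(\emptyset)=0$, $\mu(X)=1$, and monotone. A subset $A\subset X$ is a set of indifference for $\mu$ if for all $B_1,B_2\subset A$ with $|B_1|=|B_2|$ and all $C\subset X\setminus A$, $\mu(B_1\cup C)=\mu(B_2\cup C)$. $\mu$ is $p$-symmetric with respect to the partition $\{A_1,\dots,A_p\}$ of $X$ (all $A_i\ne\emptyset$) if this is the coarsest partition of $X$ into sets of indifference for $\mu$. The profile of $C\subset X$ is $(c_1,\dots,c_p)$ with $c_i=|C\cap A_i|$. The Möbius transform is $m(A)=\sum_{B\subset A}(-1)^{|A\setminus B|}\mu(B)$; for $p$-symmetric $\mu$, $m(C)$ depends only on the profile of $C$, and $m(c_1,\dots,c_p)$ denotes this common value. The Shapley interaction index of $A\subset X$ is $I(A)=\sum_{B\subset X\setminus A}\frac{(n-|B|-|A|)!\,|B|!}{(n-|A|+1)!}\sum_{C\subset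 A}(-1)^{|A|-|C|}\mu(B\cup C)$; it satisfies $I(A)=\sum_{B\subset X\setminus A}\frac{1}{|B|+1}m(A\cup B)$.
   Formalization: The fuzzy measure μ takes only rational values in $[0,1]$. -}

module Defs where

open import Data.Bool using (Bool; true; false; if_then_else_)
open import Data.Nat as ℕ using (ℕ; zero; suc; _∸_; _!)
open import Data.Nat.Properties using (_!≢0)
open import Data.Nat.Combinatorics using (_C_)
open import Data.Fin as Fin using (Fin)
open import Data.Fin.Subset using (Subset; _⊆_; _∩_; _∪_; ∁; ∣_∣; ⊥; ⊤; inside; outside)
open import Data.Fin.Subset.Properties using (_⊆?_)
open import Data.Vec as Vec using (Vec; []; _∷_; tabulate)
open import Data.List as List using (List; []; _∷_; map; concatMap; filter; upTo; foldr)
open import Data.Integer using (+_)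
open import Data.Rational as ℚ using (ℚ; 0ℚ; 1ℚ; _+_; _*_; -_; _/_; _≤_)
open import Data.Product using (Σ; ∃; _×_)
open import Relation.Binary.PropositionalEquality using (_≡_)
open import Relation.Nullary using (does)

allSubsets : (n : ℕ) → List (Subset n)
allSubsets zero = [] ∷ []
allSubsets (suc n) = concatMap (λ s → (outside ∷ s) ∷ (inside ∷ s) ∷ []) (allSubsets n)

subsetsOf : {n : ℕ} → Subset n → List (Subset n)
subsetsOf {n} A = filter (λ B → B ⊆? A) (allSubsets n)

sumℚ : List ℚ → ℚ
sumℚ = foldr _+_ 0ℚ

neg1^ : ℕ → ℚ
neg1^ zero = 1ℚ
neg1^ (suc k) = - neg1^ k

ℕ→ℚ : ℕ → ℚ
ℕ→ℚ k = (+ k) / 1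

record IsFuzzyMeasure {n : ℕ} (μ : Subset n → ℚ) : Set where
  field
    empty    : μ ⊥ ≡ 0ℚ
    full     : μ ⊤ ≡ 1ℚ
    range    : ∀ A → (0ℚ ≤ μ A) × (μ A ≤ 1ℚ)
    monotone : ∀ A B → A ⊆ B → μ A ≤ μ B

IsIndifference : {n : ℕ} → (Subset n → ℚ) → Subset n → Set
IsIndifference μ A =
  ∀ B₁ B₂ C → B₁ ⊆ A → B₂ ⊆ A → ∣ B₁ ∣ ≡ ∣ B₂ ∣ → C ⊆ ∁ A →
  μ (B₁ ∪ C) ≡ μ (B₂ ∪ C)

-- a partition of Fin n into k (possibly empty) blocks is given by a
-- block-assignment map q : Fin n → Fin k; block j is q⁻¹(j)
block : {n k : ℕ} → (Fin n → Fin k) → Fin k → Subset n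
block q j = tabulate (λ x → does (q x Fin.≟ j))

Surjective : {n k : ℕ} → (Fin n → Fin k) → Set
Surjective {n} {k} q = ∀ (j : Fin k) → ∃ λ (x : Fin n) → q x ≡ j

AllIndifference : {n k : ℕ} → (Subset n → ℚ) → (Fin n → Fin k) → Set
AllIndifference μ q = ∀ j → IsIndifference μ (block q j)

-- μ is p-symmetric w.r.t. the partition {A_1..A_p} given by `part`:
-- all blocks nonempty, all blocks sets of indifference, and it is the
-- coarsest such partition (every partition into nonempty sets of
-- indifference refines it).
IsPSymmetric : {n p : ℕ} → (Subset n → ℚ) → (Fin n → Fin p) → Set
IsPSymmetric {n} μ part =
  Surjective part × AllIndifference μ part ×
  (∀ (k : ℕ) (q : Fin n → Fin k) → Surjective q → AllIndifference μ q →
     ∀ x y → q x ≡ q y → part x ≡ part y)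

profile : {n p : ℕ} → (Fin n → Fin p) → Subset n → Vec ℕ p
profile part C = tabulate (λ i → ∣ C ∩ block part i ∣)

blockSizes : {n p : ℕ} → (Fin n → Fin p) → Vec ℕ p
blockSizes part = tabulate (λ i → ∣ block part i ∣)

mobius : {n : ℕ} → (Subset n → ℚ) → Subset n → ℚ
mobius μ A = sumℚ (map (λ B → neg1^ ∣ A ∩ ∁ B ∣ * μ B) (subsetsOf A))

shapleyInteraction : {n : ℕ} → (Subset n → ℚ) → Subset n → ℚ
shapleyInteraction {n} μ A =
  sumℚ (map (λ B →
     ((+ ((n ∸ ∣ B ∣ ∸ ∣ A ∣) ! ℕ.* ∣ B ∣ !)) / (suc (n ∸ ∣ A ∣)) !) {{(suc (n ∸ ∣ A ∣)) !≢0}}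
     * sumℚ (map (λ C → neg1^ (∣ A ∣ ∸ ∣ C ∣) * μ (B ∪ C)) (subsetsOf A)))
   (subsetsOf (∁ A)))

-- integers l, l+1, …, h  (empty if h < l)
range : ℕ → ℕ → List ℕ
range l h = map (l ℕ.+_) (upTo (suc h ∸ l))

box : {p : ℕ} → Vec ℕ p → Vec ℕ p → List (Vec ℕ p)
box [] [] = [] ∷ []
box (l ∷ ls) (h ∷ hs) = concatMap (λ c → map (c ∷_) (box ls hs)) (range l h)

sumVec : {p : ℕ} → Vec ℕ p → ℕ
sumVec = Vec.foldr _ ℕ._+_ 0

binomProd : {p : ℕ} → Vec ℕ p → Vec ℕ p → Vec ℕ p → ℕ
binomProd [] [] [] = 1
binomProd (a ∷ as) (b ∷ bs) (c ∷ cs) = ((a ∸ b) C (c ∸ b)) ℕ.* binomProd as bs cs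

-- right-hand side of Proposition 4.3, where mp c stands for m(c_1,…,c_p)
propRHS : {p : ℕ} → (a b : Vec ℕ p) → (Vec ℕ p → ℚ) → ℚ
propRHS a b mp =
  sumℚ (map (λ c →
     ((+ 1) / suc (sumVec c ∸ sumVec b)) * ℕ→ℚ (binomProd a b c) * mp c)
   (box b a))

module Submission where

-- After some
-- bookkeeping on finite sums, the file establishes, in order:
--   * Möbius inversion of finite differences, Δ_A μ (X) = Σ_{T ⊑ X} m(A ∪ T),
--     and the weight identity Σ_{T ⊑ X ⊑ ∁A} w(|X|) = 1/(|T|+1) (a
--     hockey-stick computation); with Fubini these give, for every set
--     function μ, the Möbius form  I(A) = Σ_{T ⊑ ∁A} m(A ∪ T) / (|T|+1);
--   * the counting lemma: summing a function of the profile over an interval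
--     of subsets is a binomially weighted sum over a box of profiles (one
--     element at a time, by Pascal's rule);
--   * symmetry: if every block is a set of indifference, μ and hence m take
--     equal values on sets of equal profile (T is turned into T′ block by block).
-- The theorem translates the Möbius form to an interval above B, applies the
-- counting lemma and identifies the result with the box sum of the statement.

open import Defs
open import Data.Nat using (ℕ)
open import Data.Fin using (Fin)
open import Data.Fin.Subset using (Subset)
open import Data.Vec using (Vec)
open import Data.List.Membership.Propositional using (_∈_)
open import Data.Rational using (ℚ)
open import Relation.Binary.PropositionalEquality using (_≡_)

open import Data.Bool as Bool using (Bool; true; false; if_then_else_; _∧_; _∨_; not)
import Data.Bool.Properties as BoolP
open import Data.Nat as ℕ using (zero; suc; _∸_; _!; _≤_; _<_; z≤n; s≤s)
import Data.Nat.Properties as ℕP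
open import Data.Nat.Properties using (_!≢0; _!*_!≢0)
open import Data.Nat.Combinatorics
  using (_C_; nCk+nC[k+1]≡[n+1]C[k+1]; k>n⇒nCk≡0; nCk≡n!/k![n-k]!; k![n∸k]!∣n!)
open import Data.Nat.DivMod using (m/n*n≡m)
import Data.Nat.Solver as ℕSolver
open import Data.Integer as ℤ using (+_)
import Data.Integer.Properties as ℤP
open import Data.Fin as Fin using ()
open import Data.Fin.Subset using (_∩_; _∪_; ∁; ∣_∣; ⊥; ⊤; outside; inside)
import Data.Fin.Subset.Properties as SubsetP
open import Data.Vec as Vec using ([]; _∷_; tabulate; lookup)
import Data.Vec.Properties as VecP
open import Data.List as List using (List; []; _∷_; map; filter; concatMap; upTo; applyUpTo)
import Data.List.Properties as ListP
import Data.List.Membership.Propositional.Properties as MembershipP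
open import Data.List.Relation.Unary.Any using (here)
import Data.List.Membership.DecPropositional as DecMembership
open import Data.Rational as ℚ using (0ℚ; 1ℚ; _+_; _*_; -_; _/_; fromℚᵘ)
import Data.Rational.Properties as ℚP
open import Data.Rational.Unnormalised as ℚᵘ using (mkℚᵘ; *≡*)
import Data.Rational.Unnormalised.Properties as ℚᵘP
import Data.Rational.Solver as ℚSolver
open import Algebra.Bundles using (CommutativeMonoid)
open import Algebra.Properties.CommutativeSemigroup
  (CommutativeMonoid.commutativeSemigroup ℚP.+-0-commutativeMonoid)
  using () renaming (interchange to +-interchange)
open import Data.Product using (_,_)
open import Data.Unit using (tt) renaming (⊤ to Unit)
open import Data.Empty using () renaming (⊥ to Empty)
open import Function using (_∘_)
open import Relation.Nullary using (does; Dec; yes; no)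
open import Relation.Nullary.Decidable using (dec-true)
open import Relation.Binary.PropositionalEquality
  using (refl; sym; trans; cong; cong₂; subst; subst₂; module ≡-Reasoning)

fromℚᵘ-+ : ∀ u v → fromℚᵘ (u ℚᵘ.+ v) ≡ fromℚᵘ u + fromℚᵘ v
fromℚᵘ-+ u v = ℚP.toℚᵘ-injective (ℚᵘP.≃-trans (ℚP.toℚᵘ-fromℚᵘ (u ℚᵘ.+ v))
  (ℚᵘP.≃-sym (ℚᵘP.≃-trans (ℚP.toℚᵘ-homo-+ (fromℚᵘ u) (fromℚᵘ v))
     (ℚᵘP.+-cong (ℚP.toℚᵘ-fromℚᵘ u) (ℚP.toℚᵘ-fromℚᵘ v)))))

fromℚᵘ-* : ∀ u v → fromℚᵘ (u ℚᵘ.* v) ≡ fromℚᵘ u * fromℚᵘ v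
fromℚᵘ-* u v = ℚP.toℚᵘ-injective (ℚᵘP.≃-trans (ℚP.toℚᵘ-fromℚᵘ (u ℚᵘ.* v))
  (ℚᵘP.≃-sym (ℚᵘP.≃-trans (ℚP.toℚᵘ-homo-* (fromℚᵘ u) (fromℚᵘ v))
     (ℚᵘP.*-cong (ℚP.toℚᵘ-fromℚᵘ u) (ℚP.toℚᵘ-fromℚᵘ v)))))

ℕ→ℚ-+ : ∀ x y → ℕ→ℚ (x ℕ.+ y) ≡ ℕ→ℚ x + ℕ→ℚ y
ℕ→ℚ-+ x y = trans (ℚP.fromℚᵘ-cong (*≡* {mkℚᵘ (+ (x ℕ.+ y)) 0} {mkℚᵘ (+ x) 0 ℚᵘ.+ mkℚᵘ (+ y) 0}
                                         (cong (ℤ._* + 1) numerators)))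
                  (fromℚᵘ-+ (mkℚᵘ (+ x) 0) (mkℚᵘ (+ y) 0))
  where
  numerators : + (x ℕ.+ y) ≡ + x ℤ.* + 1 ℤ.+ + y ℤ.* + 1
  numerators = trans (ℤP.pos-+ x y)
    (sym (cong₂ ℤ._+_ (ℤP.*-identityʳ (+ x)) (ℤP.*-identityʳ (+ y))))

ℕ→ℚ-* : ∀ x y → ℕ→ℚ (x ℕ.* y) ≡ ℕ→ℚ x * ℕ→ℚ y
ℕ→ℚ-* x y = trans (ℚP.fromℚᵘ-cong (*≡* {mkℚᵘ (+ (x ℕ.* y)) 0} {mkℚᵘ (+ x) 0 ℚᵘ.* mkℚᵘ (+ y) 0}
                                         (cong (ℤ._* + 1) (ℤP.pos-* x y))))
                  (fromℚᵘ-* (mkℚᵘ (+ x) 0) (mkℚᵘ (+ y) 0))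

/-*-cancel : ∀ a D .{{_ : ℕ.NonZero D}} → (+ a) / D * ℕ→ℚ D ≡ ℕ→ℚ a
/-*-cancel a (suc d) =
  trans (sym (fromℚᵘ-* (mkℚᵘ (+ a) d) (mkℚᵘ (+ suc d) 0)))
        (ℚP.fromℚᵘ-cong (*≡* {mkℚᵘ (+ a) d ℚᵘ.* mkℚᵘ (+ suc d) 0} {mkℚᵘ (+ a) 0} (trans (ℤP.*-identityʳ _)
          (cong (λ z → + a ℤ.* + z) (sym (ℕP.*-identityʳ (suc d)))))))

*-cancelʳ-ℕ : ∀ x y D .{{_ : ℕ.NonZero D}} → x * ℕ→ℚ D ≡ y * ℕ→ℚ D → x ≡ y
*-cancelʳ-ℕ x y D eq = begin
  x                         ≡⟨ sym (scale x) ⟩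
  x * ℕ→ℚ D * ((+ 1) / D)   ≡⟨ cong (_* ((+ 1) / D)) eq ⟩
  y * ℕ→ℚ D * ((+ 1) / D)   ≡⟨ scale y ⟩
  y                         ∎
  where
  open ≡-Reasoning
  scale : ∀ z → z * ℕ→ℚ D * ((+ 1) / D) ≡ z
  scale z = trans (trans (ℚP.*-assoc z (ℕ→ℚ D) ((+ 1) / D))
                         (cong (z *_) (trans (ℚP.*-comm (ℕ→ℚ D) _) (/-*-cancel 1 D))))
                  (ℚP.*-identityʳ z)

∑ₙ : ℕ → (ℕ → ℚ) → ℚ
∑ₙ zero    f = 0ℚ
∑ₙ (suc m) f = f 0 + ∑ₙ m (f ∘ suc)

∑ₙ-cong : ∀ m {f g : ℕ → ℚ} → (∀ j → f j ≡ g j) → ∑ₙ m f ≡ ∑ₙ m g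
∑ₙ-cong zero    eq = refl
∑ₙ-cong (suc m) eq = cong₂ _+_ (eq 0) (∑ₙ-cong m (eq ∘ suc))

∑ₙ-+ : ∀ m (f g : ℕ → ℚ) → ∑ₙ m (λ j → f j + g j) ≡ ∑ₙ m f + ∑ₙ m g
∑ₙ-+ zero    f g = sym (ℚP.+-identityˡ 0ℚ)
∑ₙ-+ (suc m) f g = trans (cong (_+_ (f 0 + g 0)) (∑ₙ-+ m (f ∘ suc) (g ∘ suc)))
                         (+-interchange (f 0) (g 0) (∑ₙ m (f ∘ suc)) (∑ₙ m (g ∘ suc)))

∑ₙ-*ʳ : ∀ m (f : ℕ → ℚ) c → ∑ₙ m (λ j → f j * c) ≡ ∑ₙ m f * c
∑ₙ-*ʳ zero    f c = sym (ℚP.*-zeroˡ c)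
∑ₙ-*ʳ (suc m) f c = trans (cong (_+_ (f 0 * c)) (∑ₙ-*ʳ m (f ∘ suc) c))
                          (sym (ℚP.*-distribʳ-+ c (f 0) (∑ₙ m (f ∘ suc))))

∑ₙ-last : ∀ m (f : ℕ → ℚ) → ∑ₙ (suc m) f ≡ ∑ₙ m f + f m
∑ₙ-last zero    f = trans (ℚP.+-identityʳ (f 0)) (sym (ℚP.+-identityˡ (f 0)))
∑ₙ-last (suc m) f = trans (cong (_+_ (f 0)) (∑ₙ-last m (f ∘ suc)))
                          (sym (ℚP.+-assoc (f 0) (∑ₙ m (f ∘ suc)) (f (suc m))))

sumℚ-++ : (xs ys : List ℚ) → sumℚ (xs List.++ ys) ≡ sumℚ xs + sumℚ ys
sumℚ-++ []       ys = sym (ℚP.+-identityˡ _)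
sumℚ-++ (x ∷ xs) ys = trans (cong (_+_ x) (sumℚ-++ xs ys)) (sym (ℚP.+-assoc x (sumℚ xs) (sumℚ ys)))

sumℚ-map-cong : ∀ {A : Set} (xs : List A) {f g : A → ℚ} →
                (∀ x → f x ≡ g x) → sumℚ (map f xs) ≡ sumℚ (map g xs)
sumℚ-map-cong []       eq = refl
sumℚ-map-cong (x ∷ xs) eq = cong₂ _+_ (eq x) (sumℚ-map-cong xs eq)

sumℚ-map-+ : ∀ {A : Set} (xs : List A) (f g : A → ℚ) →
             sumℚ (map (λ x → f x + g x) xs) ≡ sumℚ (map f xs) + sumℚ (map g xs)
sumℚ-map-+ []       f g = sym (ℚP.+-identityˡ 0ℚ)
sumℚ-map-+ (x ∷ xs) f g = trans (cong (_+_ (f x + g x)) (sumℚ-map-+ xs f g))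
                                (+-interchange (f x) (g x) (sumℚ (map f xs)) (sumℚ (map g xs)))

sumℚ-map-*ˡ : ∀ {A : Set} (xs : List A) c (f : A → ℚ) →
              sumℚ (map (λ x → c * f x) xs) ≡ c * sumℚ (map f xs)
sumℚ-map-*ˡ []       c f = sym (ℚP.*-zeroʳ c)
sumℚ-map-*ˡ (x ∷ xs) c f = trans (cong (_+_ (c * f x)) (sumℚ-map-*ˡ xs c f))
                                 (sym (ℚP.*-distribˡ-+ c (f x) (sumℚ (map f xs))))

sumℚ-concatMap : ∀ {A B : Set} (xs : List A) (f : A → List B) (h : B → ℚ) →
                 sumℚ (map h (concatMap f xs)) ≡ sumℚ (map (λ x → sumℚ (map h (f x))) xs)
sumℚ-concatMap []       f h = refl
sumℚ-concatMap (x ∷ xs) f h = begin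
  sumℚ (map h (f x List.++ concatMap f xs))         ≡⟨ cong sumℚ (ListP.map-++ h (f x) (concatMap f xs)) ⟩
  sumℚ (map h (f x) List.++ map h (concatMap f xs)) ≡⟨ sumℚ-++ (map h (f x)) _ ⟩
  sumℚ (map h (f x)) + sumℚ (map h (concatMap f xs)) ≡⟨ cong (_+_ (sumℚ (map h (f x)))) (sumℚ-concatMap xs f h) ⟩
  sumℚ (map (λ y → sumℚ (map h (f y))) (x ∷ xs))     ∎
  where open ≡-Reasoning

sumℚ-filter : ∀ {A : Set} {P : A → Set} (P? : ∀ x → Dec (P x)) (xs : List A) (g : A → ℚ) →
              sumℚ (map g (filter P? xs)) ≡ sumℚ (map (λ x → if does (P? x) then g x else 0ℚ) xs)
sumℚ-filter P? []       g = refl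
sumℚ-filter P? (x ∷ xs) g with does (P? x)
... | true  = cong (_+_ (g x)) (sumℚ-filter P? xs g)
... | false = trans (sumℚ-filter P? xs g) (sym (ℚP.+-identityˡ _))

sumℚ-applyUpTo : ∀ (F : ℕ → ℚ) (f : ℕ → ℕ) m → sumℚ (map F (applyUpTo f m)) ≡ ∑ₙ m (F ∘ f)
sumℚ-applyUpTo F f zero    = refl
sumℚ-applyUpTo F f (suc m) = cong (_+_ (F (f 0))) (sumℚ-applyUpTo F (f ∘ suc) m)

-- The pointwise order on subsets, defined by recursion so that it computes.
infix 4 _⊑_
_⊑_ : ∀ {n} → Subset n → Subset n → Set
[]          ⊑ []          = Unit
(true  ∷ E) ⊑ (true  ∷ F) = E ⊑ F
(true  ∷ E) ⊑ (false ∷ F) = Empty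
(false ∷ E) ⊑ (_     ∷ F) = E ⊑ F

⊥⊑ : ∀ {n} (X : Subset n) → ⊥ ⊑ X
⊥⊑ []          = tt
⊥⊑ (true  ∷ X) = ⊥⊑ X
⊥⊑ (false ∷ X) = ⊥⊑ X

⊑⊤ : ∀ {n} (X : Subset n) → X ⊑ ⊤
⊑⊤ []          = tt
⊑⊤ (true  ∷ X) = ⊑⊤ X
⊑⊤ (false ∷ X) = ⊑⊤ X

-- Interval sums:  ∑ E F g = Σ_{E ⊑ X ⊑ F} g X  (an empty sum when E ⋢ F).
∑ : ∀ {n} → Subset n → Subset n → (Subset n → ℚ) → ℚ
∑ []          []          g = g []
∑ (true  ∷ E) (true  ∷ F) g = ∑ E F (g ∘ (true ∷_))
∑ (true  ∷ E) (false ∷ F) g = 0ℚ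
∑ (false ∷ E) (false ∷ F) g = ∑ E F (g ∘ (false ∷_))
∑ (false ∷ E) (true  ∷ F) g = ∑ E F (g ∘ (false ∷_)) + ∑ E F (g ∘ (true ∷_))

∑-cong : ∀ {n} (E F : Subset n) {f g : Subset n → ℚ} →
         (∀ X → E ⊑ X → X ⊑ F → f X ≡ g X) → ∑ E F f ≡ ∑ E F g
∑-cong []          []          eq = eq [] tt tt
∑-cong (true  ∷ E) (true  ∷ F) eq = ∑-cong E F (λ X → eq (true ∷ X))
∑-cong (true  ∷ E) (false ∷ F) eq = refl
∑-cong (false ∷ E) (false ∷ F) eq = ∑-cong E F (λ X → eq (false ∷ X))
∑-cong (false ∷ E) (true  ∷ F) eq = cong₂ _+_ (∑-cong E F (λ X → eq (false ∷ X)))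
                                              (∑-cong E F (λ X → eq (true ∷ X)))

∑-+ : ∀ {n} (E F : Subset n) (f g : Subset n → ℚ) →
      ∑ E F (λ X → f X + g X) ≡ ∑ E F f + ∑ E F g
∑-+ []          []          f g = refl
∑-+ (true  ∷ E) (true  ∷ F) f g = ∑-+ E F (f ∘ (true ∷_)) (g ∘ (true ∷_))
∑-+ (true  ∷ E) (false ∷ F) f g = sym (ℚP.+-identityˡ 0ℚ)
∑-+ (false ∷ E) (false ∷ F) f g = ∑-+ E F (f ∘ (false ∷_)) (g ∘ (false ∷_))
∑-+ (false ∷ E) (true  ∷ F) f g =
  trans (cong₂ _+_ (∑-+ E F (f ∘ (false ∷_)) (g ∘ (false ∷_))) (∑-+ E F (f ∘ (true ∷_)) (g ∘ (true ∷_))))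
        (+-interchange (∑ E F (f ∘ (false ∷_))) (∑ E F (g ∘ (false ∷_)))
                       (∑ E F (f ∘ (true ∷_)))  (∑ E F (g ∘ (true ∷_))))

∑-*ˡ : ∀ {n} (E F : Subset n) c (f : Subset n → ℚ) → ∑ E F (λ X → c * f X) ≡ c * ∑ E F f
∑-*ˡ []          []          c f = refl
∑-*ˡ (true  ∷ E) (true  ∷ F) c f = ∑-*ˡ E F c (f ∘ (true ∷_))
∑-*ˡ (true  ∷ E) (false ∷ F) c f = sym (ℚP.*-zeroʳ c)
∑-*ˡ (false ∷ E) (false ∷ F) c f = ∑-*ˡ E F c (f ∘ (false ∷_))
∑-*ˡ (false ∷ E) (true  ∷ F) c f =
  trans (cong₂ _+_ (∑-*ˡ E F c (f ∘ (false ∷_))) (∑-*ˡ E F c (f ∘ (true ∷_))))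
        (sym (ℚP.*-distribˡ-+ c (∑ E F (f ∘ (false ∷_))) (∑ E F (f ∘ (true ∷_)))))

∑-*ʳ : ∀ {n} (E F : Subset n) c (f : Subset n → ℚ) → ∑ E F (λ X → f X * c) ≡ ∑ E F f * c
∑-*ʳ E F c f = trans (∑-cong E F (λ X _ _ → ℚP.*-comm (f X) c))
                     (trans (∑-*ˡ E F c f) (ℚP.*-comm c (∑ E F f)))

∑-neg : ∀ {n} (E F : Subset n) (f : Subset n → ℚ) → ∑ E F (λ X → - f X) ≡ - ∑ E F f
∑-neg E F f = trans (∑-cong E F (λ X _ _ → neg≡-1* (f X)))
                    (trans (∑-*ˡ E F (- 1ℚ) f) (sym (neg≡-1* (∑ E F f))))
  where
  neg≡-1* : ∀ x → - x ≡ - 1ℚ * x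
  neg≡-1* x = trans (cong -_ (sym (ℚP.*-identityˡ x))) (ℚP.neg-distribˡ-* 1ℚ x)

∑-zero : ∀ {n} (E F : Subset n) → ∑ E F (λ _ → 0ℚ) ≡ 0ℚ
∑-zero E F = trans (∑-cong E F (λ _ _ _ → sym (ℚP.*-zeroˡ 0ℚ))) (trans (∑-*ˡ E F 0ℚ (λ _ → 0ℚ)) (ℚP.*-zeroˡ (∑ E F (λ _ → 0ℚ))))

∑-swap : ∀ {n} (E F : Subset n) (h : Subset n → Subset n → ℚ) →
         ∑ E F (λ X → ∑ E X (h X)) ≡ ∑ E F (λ T → ∑ T F (λ X → h X T))
∑-swap []          []          h = refl
∑-swap (true  ∷ E) (true  ∷ F) h = ∑-swap E F (λ X T → h (true ∷ X) (true ∷ T))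
∑-swap (true  ∷ E) (false ∷ F) h = refl
∑-swap (false ∷ E) (false ∷ F) h = ∑-swap E F (λ X T → h (false ∷ X) (false ∷ T))
∑-swap {suc n} (false ∷ E) (true ∷ F) h = begin
  ∑ E F (λ X → ∑ E X (h₀₀ X)) + ∑ E F (λ X → ∑ E X (h₁₀ X) + ∑ E X (h₁₁ X))
    ≡⟨ cong (_+_ (∑ E F (λ X → ∑ E X (h₀₀ X)))) (∑-+ E F (λ X → ∑ E X (h₁₀ X)) (λ X → ∑ E X (h₁₁ X))) ⟩
  ∑ E F (λ X → ∑ E X (h₀₀ X)) + (∑ E F (λ X → ∑ E X (h₁₀ X)) + ∑ E F (λ X → ∑ E X (h₁₁ X)))
    ≡⟨ sym (ℚP.+-assoc (∑ E F (λ X → ∑ E X (h₀₀ X))) (∑ E F (λ X → ∑ E X (h₁₀ X))) (∑ E F (λ X → ∑ E X (h₁₁ X)))) ⟩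
  ∑ E F (λ X → ∑ E X (h₀₀ X)) + ∑ E F (λ X → ∑ E X (h₁₀ X)) + ∑ E F (λ X → ∑ E X (h₁₁ X))
    ≡⟨ cong₂ _+_ (cong₂ _+_ (∑-swap E F h₀₀) (∑-swap E F h₁₀)) (∑-swap E F h₁₁) ⟩
  ∑ E F (λ T → ∑ T F (λ X → h₀₀ X T)) + ∑ E F (λ T → ∑ T F (λ X → h₁₀ X T)) + ∑ E F (λ T → ∑ T F (λ X → h₁₁ X T))
    ≡⟨ cong (_+ ∑ E F (λ T → ∑ T F (λ X → h₁₁ X T)))
            (sym (∑-+ E F (λ T → ∑ T F (λ X → h₀₀ X T)) (λ T → ∑ T F (λ X → h₁₀ X T)))) ⟩
  ∑ E F (λ T → ∑ T F (λ X → h₀₀ X T) + ∑ T F (λ X → h₁₀ X T)) + ∑ E F (λ T → ∑ T F (λ X → h₁₁ X T))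
    ∎
  where
  open ≡-Reasoning
  h₀₀ h₁₀ h₁₁ : Subset n → Subset n → ℚ
  h₀₀ X T = h (false ∷ X) (false ∷ T)
  h₁₀ X T = h (true ∷ X) (false ∷ T)
  h₁₁ X T = h (true ∷ X) (true ∷ T)

-- Translation: the sets B ∪ T with T ⊑ ∁B are exactly the supersets of B.
∑-translate : ∀ {n} (B : Subset n) (f : Subset n → ℚ) → ∑ ⊥ (∁ B) (λ T → f (B ∪ T)) ≡ ∑ B ⊤ f
∑-translate []          f = refl
∑-translate (true  ∷ B) f = ∑-translate B (f ∘ (true ∷_))
∑-translate (false ∷ B) f = cong₂ _+_ (∑-translate B (f ∘ (false ∷_))) (∑-translate B (f ∘ (true ∷_)))

⊑-card : ∀ {n} (E F : Subset n) → E ⊑ F → ∣ E ∣ ≤ ∣ F ∣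
⊑-card []          []          _  = z≤n
⊑-card (true  ∷ E) (true  ∷ F) le = s≤s (⊑-card E F le)
⊑-card (true  ∷ E) (false ∷ F) ()
⊑-card (false ∷ E) (false ∷ F) le = ⊑-card E F le
⊑-card (false ∷ E) (true  ∷ F) le = ℕP.m≤n⇒m≤1+n (⊑-card E F le)

card-difference : ∀ {n} (U D : Subset n) → U ⊑ D → ∣ D ∩ ∁ U ∣ ≡ ∣ D ∣ ∸ ∣ U ∣
card-difference []          []          _  = refl
card-difference (true  ∷ U) (true  ∷ D) le = card-difference U D le
card-difference (true  ∷ U) (false ∷ D) ()
card-difference (false ∷ U) (false ∷ D) le = card-difference U D le
card-difference (false ∷ U) (true  ∷ D) le =
  trans (cong suc (card-difference U D le)) (sym (ℕP.+-∸-assoc 1 (⊑-card U D le)))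

card-∪-disjoint : ∀ {n} (B T : Subset n) → T ⊑ ∁ B → ∣ B ∪ T ∣ ≡ ∣ B ∣ ℕ.+ ∣ T ∣
card-∪-disjoint []          []          _  = refl
card-∪-disjoint (true  ∷ B) (true  ∷ T) ()
card-∪-disjoint (true  ∷ B) (false ∷ T) le = cong suc (card-∪-disjoint B T le)
card-∪-disjoint (false ∷ B) (false ∷ T) le = card-∪-disjoint B T le
card-∪-disjoint (false ∷ B) (true  ∷ T) le =
  trans (cong suc (card-∪-disjoint B T le)) (sym (ℕP.+-suc ∣ B ∣ ∣ T ∣))

sumℚ-allSubsets : ∀ n (g : Subset n → ℚ) → sumℚ (map g (allSubsets n)) ≡ ∑ ⊥ ⊤ g
sumℚ-allSubsets zero    g = ℚP.+-identityʳ (g [])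
sumℚ-allSubsets (suc n) g = begin
  sumℚ (map g (allSubsets (suc n)))
    ≡⟨ sumℚ-concatMap (allSubsets n) (λ s → (outside ∷ s) ∷ (inside ∷ s) ∷ []) g ⟩
  sumℚ (map (λ s → g (outside ∷ s) + (g (inside ∷ s) + 0ℚ)) (allSubsets n))
    ≡⟨ sumℚ-map-cong (allSubsets n) (λ s → cong (_+_ (g (outside ∷ s))) (ℚP.+-identityʳ _)) ⟩
  sumℚ (map (λ s → g (outside ∷ s) + g (inside ∷ s)) (allSubsets n))
    ≡⟨ sumℚ-map-+ (allSubsets n) (g ∘ (outside ∷_)) (g ∘ (inside ∷_)) ⟩
  sumℚ (map (g ∘ (outside ∷_)) (allSubsets n)) + sumℚ (map (g ∘ (inside ∷_)) (allSubsets n))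
    ≡⟨ cong₂ _+_ (sumℚ-allSubsets n (g ∘ (outside ∷_))) (sumℚ-allSubsets n (g ∘ (inside ∷_))) ⟩
  ∑ ⊥ ⊤ (g ∘ (outside ∷_)) + ∑ ⊥ ⊤ (g ∘ (inside ∷_)) ∎
  where open ≡-Reasoning

∑-indicator : ∀ {n} (A : Subset n) (g : Subset n → ℚ) →
              ∑ ⊥ ⊤ (λ S → if does (S SubsetP.⊆? A) then g S else 0ℚ) ≡ ∑ ⊥ A g
∑-indicator         []          g = refl
∑-indicator         (true  ∷ A) g = cong₂ _+_ (∑-indicator A (g ∘ (false ∷_))) (∑-indicator A (g ∘ (true ∷_)))
∑-indicator {suc n} (false ∷ A) g = trans (cong₂ _+_ (∑-indicator A (g ∘ (false ∷_))) (∑-zero {n} ⊥ ⊤))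
                                          (ℚP.+-identityʳ _)

sumℚ-subsetsOf : ∀ {n} (A : Subset n) (g : Subset n → ℚ) → sumℚ (map g (subsetsOf A)) ≡ ∑ ⊥ A g
sumℚ-subsetsOf {n} A g = trans (sumℚ-filter (SubsetP._⊆? A) (allSubsets n) g)
                               (trans (sumℚ-allSubsets n _) (∑-indicator A g))

∑-sign : ∀ {n} (E F : Subset n) (k : Subset n → ℕ) (f : Subset n → ℚ) →
         ∑ E F (λ U → neg1^ (suc (k U)) * f U) ≡ - ∑ E F (λ U → neg1^ (k U) * f U)
∑-sign E F k f = trans (∑-cong E F (λ U _ _ → sym (ℚP.neg-distribˡ-* (neg1^ (k U)) (f U))))
                       (∑-neg E F (λ U → neg1^ (k U) * f U))

∑-difference : ∀ {n} (E F : Subset n) (f g : Subset n → ℚ) →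
               - ∑ E F f + ∑ E F g ≡ ∑ E F (λ X → - f X + g X)
∑-difference E F f g = trans (cong (_+ ∑ E F g) (sym (∑-neg E F f))) (sym (∑-+ E F (λ X → - f X) g))

mobiusᴵ : ∀ {n} → (Subset n → ℚ) → Subset n → ℚ
mobiusᴵ μ D = ∑ ⊥ D (λ U → neg1^ ∣ D ∩ ∁ U ∣ * μ U)

mobius≡mobiusᴵ : ∀ {n} (μ : Subset n → ℚ) (D : Subset n) → mobius μ D ≡ mobiusᴵ μ D
mobius≡mobiusᴵ μ D = sumℚ-subsetsOf D (λ U → neg1^ ∣ D ∩ ∁ U ∣ * μ U)

mobiusᴵ-inside : ∀ {n} (μ : Subset (suc n) → ℚ) (D : Subset n) →
                 mobiusᴵ μ (true ∷ D) ≡ - mobiusᴵ (μ ∘ (false ∷_)) D + mobiusᴵ (μ ∘ (true ∷_)) D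
mobiusᴵ-inside μ D = cong (_+ mobiusᴵ (μ ∘ (true ∷_)) D) (∑-sign ⊥ D (λ U → ∣ D ∩ ∁ U ∣) (μ ∘ (false ∷_)))

Δ : ∀ {n} → (Subset n → ℚ) → Subset n → Subset n → ℚ
Δ μ A X = ∑ ⊥ A (λ U → neg1^ ∣ A ∩ ∁ U ∣ * μ (X ∪ U))

Δ-mobius : ∀ {n} (μ : Subset n → ℚ) (A X : Subset n) → X ⊑ ∁ A →
           Δ μ A X ≡ ∑ ⊥ X (λ T → mobiusᴵ μ (A ∪ T))
Δ-mobius μ []          []          _ = refl
Δ-mobius μ (true  ∷ A) (true  ∷ X) ()
Δ-mobius μ (false ∷ A) (false ∷ X) X⊑∁A = Δ-mobius (μ ∘ (false ∷_)) A X X⊑∁A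
Δ-mobius μ (true  ∷ A) (false ∷ X) X⊑∁A = begin
  ∑ ⊥ A (λ U → neg1^ (suc ∣ A ∩ ∁ U ∣) * μ₀ (X ∪ U)) + Δ μ₁ A X
    ≡⟨ cong (_+ Δ μ₁ A X) (∑-sign ⊥ A (λ U → ∣ A ∩ ∁ U ∣) (λ U → μ₀ (X ∪ U))) ⟩
  - Δ μ₀ A X + Δ μ₁ A X
    ≡⟨ cong₂ (λ u v → - u + v) (Δ-mobius μ₀ A X X⊑∁A) (Δ-mobius μ₁ A X X⊑∁A) ⟩
  - ∑ ⊥ X M₀ + ∑ ⊥ X M₁
    ≡⟨ ∑-difference ⊥ X M₀ M₁ ⟩
  ∑ ⊥ X (λ T → - M₀ T + M₁ T)
    ≡⟨ ∑-cong ⊥ X (λ T _ _ → sym (mobiusᴵ-inside μ (A ∪ T))) ⟩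
  ∑ ⊥ X (λ T → mobiusᴵ μ (true ∷ (A ∪ T))) ∎
  where
  open ≡-Reasoning
  μ₀ μ₁ : Subset _ → ℚ
  μ₀ = μ ∘ (false ∷_)
  μ₁ = μ ∘ (true ∷_)
  M₀ M₁ : Subset _ → ℚ
  M₀ T = mobiusᴵ μ₀ (A ∪ T)
  M₁ T = mobiusᴵ μ₁ (A ∪ T)
Δ-mobius μ (false ∷ A) (true  ∷ X) X⊑∁A = begin
  Δ μ₁ A X                                   ≡⟨ Δ-mobius μ₁ A X X⊑∁A ⟩
  ∑ ⊥ X M₁                                   ≡⟨ sym (+-cancel (∑ ⊥ X M₀) (∑ ⊥ X M₁)) ⟩
  ∑ ⊥ X M₀ + (- ∑ ⊥ X M₀ + ∑ ⊥ X M₁)         ≡⟨ cong (_+_ (∑ ⊥ X M₀)) (∑-difference ⊥ X M₀ M₁) ⟩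
  ∑ ⊥ X M₀ + ∑ ⊥ X (λ T → - M₀ T + M₁ T)     ≡⟨ cong (_+_ (∑ ⊥ X M₀))
                                                     (∑-cong ⊥ X (λ T _ _ → sym (mobiusᴵ-inside μ (A ∪ T)))) ⟩
  ∑ ⊥ X M₀ + ∑ ⊥ X (λ T → mobiusᴵ μ (true ∷ (A ∪ T))) ∎
  where
  open ≡-Reasoning
  μ₀ μ₁ : Subset _ → ℚ
  μ₀ = μ ∘ (false ∷_)
  μ₁ = μ ∘ (true ∷_)
  M₀ M₁ : Subset _ → ℚ
  M₀ T = mobiusᴵ μ₀ (A ∪ T)
  M₁ T = mobiusᴵ μ₁ (A ∪ T)
  +-cancel : ∀ a b → a + (- a + b) ≡ b
  +-cancel = solve 2 (λ a b → a :+ (:- a :+ b) := b) refl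
    where open ℚSolver.+-*-Solver

∑ℕ : ℕ → (ℕ → ℕ) → ℕ
∑ℕ zero    f = 0
∑ℕ (suc m) f = f 0 ℕ.+ ∑ℕ m (f ∘ suc)

∑ℕ-last : ∀ m f → ∑ℕ (suc m) f ≡ ∑ℕ m f ℕ.+ f m
∑ℕ-last zero    f = ℕP.+-identityʳ (f 0)
∑ℕ-last (suc m) f = trans (cong (f 0 ℕ.+_) (∑ℕ-last m (f ∘ suc))) (sym (ℕP.+-assoc (f 0) _ _))

∑ℕ-*ˡ : ∀ m c f → ∑ℕ m (λ j → c ℕ.* f j) ≡ c ℕ.* ∑ℕ m f
∑ℕ-*ˡ zero    c f = sym (ℕP.*-zeroʳ c)
∑ℕ-*ˡ (suc m) c f = trans (cong (c ℕ.* f 0 ℕ.+_) (∑ℕ-*ˡ m c (f ∘ suc))) (sym (ℕP.*-distribˡ-+ c (f 0) _))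

∑ℕ-cong : ∀ m {f g} → (∀ j → j < m → f j ≡ g j) → ∑ℕ m f ≡ ∑ℕ m g
∑ℕ-cong zero    eq = refl
∑ℕ-cong (suc m) eq = cong₂ ℕ._+_ (eq 0 (s≤s z≤n)) (∑ℕ-cong m (λ j j<m → eq (suc j) (s≤s j<m)))

ℕ→ℚ-∑ℕ : ∀ m (f : ℕ → ℕ) → ℕ→ℚ (∑ℕ m f) ≡ ∑ₙ m (ℕ→ℚ ∘ f)
ℕ→ℚ-∑ℕ zero    f = refl
ℕ→ℚ-∑ℕ (suc m) f = trans (ℕ→ℚ-+ (f 0) (∑ℕ m (f ∘ suc))) (cong (_+_ (ℕ→ℚ (f 0))) (ℕ→ℚ-∑ℕ m (f ∘ suc)))

binomial-factorials : ∀ {n k} → k ≤ n → (n C k) ℕ.* (k ! ℕ.* (n ∸ k) !) ≡ n !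
binomial-factorials {n} {k} k≤n = trans (cong (ℕ._* (k ! ℕ.* (n ∸ k) !)) (nCk≡n!/k![n-k]! k≤n))
                                        (m/n*n≡m {{k !* (n ∸ k) !≢0}} (k![n∸k]!∣n! k≤n))

hockey-stick : ∀ t k → ∑ℕ (suc k) (λ j → (t ℕ.+ j) C j) ≡ suc (t ℕ.+ k) C k
hockey-stick t zero    = refl
hockey-stick t (suc k) = begin
  ∑ℕ (suc (suc k)) (λ j → (t ℕ.+ j) C j)                 ≡⟨ ∑ℕ-last (suc k) (λ j → (t ℕ.+ j) C j) ⟩
  ∑ℕ (suc k) (λ j → (t ℕ.+ j) C j) ℕ.+ (t ℕ.+ suc k) C suc k
    ≡⟨ cong₂ ℕ._+_ (hockey-stick t k) (cong (_C suc k) (ℕP.+-suc t k)) ⟩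
  suc (t ℕ.+ k) C k ℕ.+ suc (t ℕ.+ k) C suc k             ≡⟨ nCk+nC[k+1]≡[n+1]C[k+1] (suc (t ℕ.+ k)) k ⟩
  suc (suc (t ℕ.+ k)) C suc k                             ≡⟨ cong (λ z → suc z C suc k) (sym (ℕP.+-suc t k)) ⟩
  suc (t ℕ.+ suc k) C suc k                               ∎
  where open ≡-Reasoning

binomial-term : ∀ t k j → j ≤ k →
                (k C j) ℕ.* ((k ∸ j) ! ℕ.* (t ℕ.+ j) !) ≡ k ! ℕ.* t ! ℕ.* ((t ℕ.+ j) C j)
binomial-term t k j j≤k = ℕP.*-cancelʳ-≡ _ _ (j !) {{j !≢0}} (begin
  (k C j) ℕ.* ((k ∸ j) ! ℕ.* (t ℕ.+ j) !) ℕ.* j !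
    ≡⟨ solve 4 (λ c a b x → c :* (a :* x) :* b := c :* (b :* a) :* x) refl (k C j) ((k ∸ j) !) (j !) ((t ℕ.+ j) !) ⟩
  (k C j) ℕ.* (j ! ℕ.* (k ∸ j) !) ℕ.* (t ℕ.+ j) !
    ≡⟨ cong (ℕ._* (t ℕ.+ j) !) (binomial-factorials j≤k) ⟩
  k ! ℕ.* (t ℕ.+ j) !
    ≡⟨ cong (k ! ℕ.*_) (sym (trans (cong (λ z → ((t ℕ.+ j) C j) ℕ.* (j ! ℕ.* z !)) (sym (ℕP.m+n∸n≡m t j)))
                                   (binomial-factorials (ℕP.m≤n+m j t)))) ⟩
  k ! ℕ.* (((t ℕ.+ j) C j) ℕ.* (j ! ℕ.* t !))
    ≡⟨ solve 4 (λ a b c d → a :* (c :* (d :* b)) := a :* b :* c :* d) refl (k !) (t !) ((t ℕ.+ j) C j) (j !) ⟩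
  k ! ℕ.* t ! ℕ.* ((t ℕ.+ j) C j) ℕ.* j ! ∎)
  where
  open ≡-Reasoning
  open ℕSolver.+-*-Solver

factorial-sum : ∀ t k → suc t ℕ.* ∑ℕ (suc k) (λ j → (k C j) ℕ.* ((k ∸ j) ! ℕ.* (t ℕ.+ j) !)) ≡ suc (t ℕ.+ k) !
factorial-sum t k = begin
  suc t ℕ.* ∑ℕ (suc k) (λ j → (k C j) ℕ.* ((k ∸ j) ! ℕ.* (t ℕ.+ j) !))
    ≡⟨ cong (suc t ℕ.*_) (∑ℕ-cong (suc k) (λ j j<sk → binomial-term t k j (ℕP.≤-pred j<sk))) ⟩
  suc t ℕ.* ∑ℕ (suc k) (λ j → k ! ℕ.* t ! ℕ.* ((t ℕ.+ j) C j))
    ≡⟨ cong (suc t ℕ.*_) (∑ℕ-*ˡ (suc k) (k ! ℕ.* t !) (λ j → (t ℕ.+ j) C j)) ⟩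
  suc t ℕ.* (k ! ℕ.* t ! ℕ.* ∑ℕ (suc k) (λ j → (t ℕ.+ j) C j))
    ≡⟨ cong (λ z → suc t ℕ.* (k ! ℕ.* t ! ℕ.* z)) (hockey-stick t k) ⟩
  suc t ℕ.* (k ! ℕ.* t ! ℕ.* (suc (t ℕ.+ k) C k))
    ≡⟨ solve 4 (λ s a b c → s :* (a :* b :* c) := c :* (a :* (s :* b))) refl (suc t) (k !) (t !) (suc (t ℕ.+ k) C k) ⟩
  (suc (t ℕ.+ k) C k) ℕ.* (k ! ℕ.* suc t !)
    ≡⟨ cong (λ z → (suc (t ℕ.+ k) C k) ℕ.* (k ! ℕ.* z !)) (sym (ℕP.m+n∸n≡m (suc t) k)) ⟩
  (suc (t ℕ.+ k) C k) ℕ.* (k ! ℕ.* (suc (t ℕ.+ k) ∸ k) !)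
    ≡⟨ binomial-factorials (ℕP.≤-trans (ℕP.m≤n+m k t) (ℕP.n≤1+n _)) ⟩
  suc (t ℕ.+ k) ! ∎
  where
  open ≡-Reasoning
  open ℕSolver.+-*-Solver

shapleyWeight : ℕ → ℕ → ℕ → ℚ
shapleyWeight n a x = ((+ ((n ∸ x ∸ a) ! ℕ.* x !)) / (suc (n ∸ a)) !) {{(suc (n ∸ a)) !≢0}}

weight-identity : ∀ t k D .{{_ : ℕ.NonZero D}} → D ≡ suc (t ℕ.+ k) ! →
  ∑ₙ (suc k) (λ j → ℕ→ℚ (k C j) * ((+ ((k ∸ j) ! ℕ.* (t ℕ.+ j) !)) / D)) ≡ (+ 1) / suc t
weight-identity t k D D≡ = *-cancelʳ-ℕ _ _ D (begin
  ∑ₙ (suc k) term * ℕ→ℚ D                   ≡⟨ sym (∑ₙ-*ʳ (suc k) term (ℕ→ℚ D)) ⟩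
  ∑ₙ (suc k) (λ j → term j * ℕ→ℚ D)         ≡⟨ ∑ₙ-cong (suc k) cancel-denominator ⟩
  ∑ₙ (suc k) (ℕ→ℚ ∘ integral)               ≡⟨ sym (ℕ→ℚ-∑ℕ (suc k) integral) ⟩
  ℕ→ℚ S                                     ≡⟨ sym (ℚP.*-identityˡ (ℕ→ℚ S)) ⟩
  1ℚ * ℕ→ℚ S                                ≡⟨ cong (_* ℕ→ℚ S) (sym (/-*-cancel 1 (suc t))) ⟩
  (+ 1) / suc t * ℕ→ℚ (suc t) * ℕ→ℚ S       ≡⟨ ℚP.*-assoc ((+ 1) / suc t) (ℕ→ℚ (suc t)) (ℕ→ℚ S) ⟩
  (+ 1) / suc t * (ℕ→ℚ (suc t) * ℕ→ℚ S)     ≡⟨ cong ((+ 1) / suc t *_) (sym (ℕ→ℚ-* (suc t) S)) ⟩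
  (+ 1) / suc t * ℕ→ℚ (suc t ℕ.* S)         ≡⟨ cong (λ z → (+ 1) / suc t * ℕ→ℚ z) (trans (factorial-sum t k) (sym D≡)) ⟩
  (+ 1) / suc t * ℕ→ℚ D                     ∎)
  where
  open ≡-Reasoning
  integral : ℕ → ℕ
  integral j = (k C j) ℕ.* ((k ∸ j) ! ℕ.* (t ℕ.+ j) !)
  S : ℕ
  S = ∑ℕ (suc k) integral
  term : ℕ → ℚ
  term j = ℕ→ℚ (k C j) * ((+ ((k ∸ j) ! ℕ.* (t ℕ.+ j) !)) / D)
  cancel-denominator : ∀ j → term j * ℕ→ℚ D ≡ ℕ→ℚ (integral j)
  cancel-denominator j = trans (ℚP.*-assoc (ℕ→ℚ (k C j)) _ (ℕ→ℚ D))
    (trans (cong (ℕ→ℚ (k C j) *_) (/-*-cancel ((k ∸ j) ! ℕ.* (t ℕ.+ j) !) D))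
           (sym (ℕ→ℚ-* (k C j) ((k ∸ j) ! ℕ.* (t ℕ.+ j) !))))

shapleyWeight-sum : ∀ n a t f → f ≡ n ∸ a → t ≤ f →
  ∑ₙ (suc f ∸ t) (λ j → ℕ→ℚ ((f ∸ t) C j) * shapleyWeight n a (t ℕ.+ j)) ≡ (+ 1) / suc t
shapleyWeight-sum n a t f f≡ t≤f rewrite ℕP.+-∸-assoc 1 t≤f =
  trans (∑ₙ-cong (suc k) (λ j → cong (λ z → ℕ→ℚ (k C j) * ((+ (z ! ℕ.* (t ℕ.+ j) !)) / D) {{D≢0}})
                                     (remaining-elements j)))
        (weight-identity t k D {{D≢0}} (cong (λ z → suc z !) (trans (sym f≡) (sym t+k≡f))))
  where
  k D : ℕ
  k = f ∸ t
  D = suc (n ∸ a) !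
  D≢0 : ℕ.NonZero D
  D≢0 = suc (n ∸ a) !≢0
  t+k≡f : t ℕ.+ k ≡ f
  t+k≡f = ℕP.m+[n∸m]≡n t≤f
  remaining-elements : ∀ j → n ∸ (t ℕ.+ j) ∸ a ≡ k ∸ j
  remaining-elements j = begin
    n ∸ (t ℕ.+ j) ∸ a         ≡⟨ ℕP.∸-+-assoc n (t ℕ.+ j) a ⟩
    n ∸ (t ℕ.+ j ℕ.+ a)       ≡⟨ cong (n ∸_) (ℕP.+-comm (t ℕ.+ j) a) ⟩
    n ∸ (a ℕ.+ (t ℕ.+ j))     ≡⟨ sym (ℕP.∸-+-assoc n a (t ℕ.+ j)) ⟩
    n ∸ a ∸ (t ℕ.+ j)         ≡⟨ cong (_∸ (t ℕ.+ j)) (trans (sym f≡) (sym t+k≡f)) ⟩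
    t ℕ.+ k ∸ (t ℕ.+ j)       ≡⟨ ℕP.[m+n]∸[m+o]≡n∸o t k j ⟩
    k ∸ j                     ∎
    where open ≡-Reasoning

inc : ∀ {p} → Fin p → Vec ℕ p → Vec ℕ p
inc Fin.zero    (x ∷ v) = suc x ∷ v
inc (Fin.suc j) (x ∷ v) = x ∷ inc j v

tabulate-inc : ∀ {n p} (j : Fin p) (g : Fin p → Subset n) →
               tabulate (λ i → ∣ does (j Fin.≟ i) ∷ g i ∣) ≡ inc j (tabulate (λ i → ∣ g i ∣))
tabulate-inc Fin.zero    g = refl
tabulate-inc (Fin.suc j) g = cong (∣ g Fin.zero ∣ ∷_) (tabulate-inc j (g ∘ Fin.suc))

profile-inside : ∀ {n p} (part : Fin (suc n) → Fin p) (S : Subset n) →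
                 profile part (true ∷ S) ≡ inc (part Fin.zero) (profile (part ∘ Fin.suc) S)
profile-inside part S = tabulate-inc (part Fin.zero) (λ i → S ∩ block (part ∘ Fin.suc) i)

-- Binomially weighted sums over a box of profiles:
--   binomialSum b a g = Σ_{b ≤ c ≤ a} Π_k C(a_k - b_k, c_k - b_k) · g c,
-- by recursion on the coordinates, writing c_k = b_k + j.
binomialSum : ∀ {p} → Vec ℕ p → Vec ℕ p → (Vec ℕ p → ℚ) → ℚ
binomialSum []       []       g = g []
binomialSum (b ∷ bs) (a ∷ as) g =
  ∑ₙ (suc a ∸ b) (λ j → ℕ→ℚ ((a ∸ b) C j) * binomialSum bs as (λ cs → g ((b ℕ.+ j) ∷ cs)))

binomialSum-cong : ∀ {p} (b a : Vec ℕ p) {g h : Vec ℕ p → ℚ} →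
                   (∀ c → g c ≡ h c) → binomialSum b a g ≡ binomialSum b a h
binomialSum-cong []       []       eq = eq []
binomialSum-cong (b ∷ bs) (a ∷ as) eq = ∑ₙ-cong (suc a ∸ b) (λ j →
  cong (ℕ→ℚ ((a ∸ b) C j) *_) (binomialSum-cong bs as (λ cs → eq ((b ℕ.+ j) ∷ cs))))

binomialSum-point : ∀ {p} (v : Vec ℕ p) (g : Vec ℕ p → ℚ) → binomialSum v v g ≡ g v
binomialSum-point []      g = refl
binomialSum-point (a ∷ v) g rewrite ℕP.+-∸-assoc 1 (ℕP.≤-refl {a}) | ℕP.n∸n≡0 a =
  trans (ℚP.+-identityʳ _) (trans (ℚP.*-identityˡ _)
    (trans (binomialSum-point v (λ cs → g ((a ℕ.+ 0) ∷ cs))) (cong (λ z → g (z ∷ v)) (ℕP.+-identityʳ a))))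

binomialSum-inc : ∀ {p} (j : Fin p) (b a : Vec ℕ p) (g : Vec ℕ p → ℚ) →
                  binomialSum (inc j b) (inc j a) g ≡ binomialSum b a (g ∘ inc j)
binomialSum-inc Fin.zero    (b ∷ bs) (a ∷ as) g = refl
binomialSum-inc (Fin.suc j) (b ∷ bs) (a ∷ as) g = ∑ₙ-cong (suc a ∸ b) (λ i →
  cong (ℕ→ℚ ((a ∸ b) C i) *_) (binomialSum-inc j bs as (λ cs → g ((b ℕ.+ i) ∷ cs))))

pascal-sum : ∀ k (h : ℕ → ℚ) →
  ∑ₙ (suc (suc k)) (λ i → ℕ→ℚ (suc k C i) * h i)
    ≡ ∑ₙ (suc k) (λ i → ℕ→ℚ (k C i) * h i) + ∑ₙ (suc k) (λ i → ℕ→ℚ (k C i) * h (suc i))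
pascal-sum k h = begin
  h₀ + ∑ₙ (suc k) (λ i → ℕ→ℚ (suc k C suc i) * h (suc i))
    ≡⟨ cong (_+_ h₀) (∑ₙ-cong (suc k) pascal-term) ⟩
  h₀ + ∑ₙ (suc k) (λ i → ℕ→ℚ (k C i) * h (suc i) + ℕ→ℚ (k C suc i) * h (suc i))
    ≡⟨ cong (_+_ h₀) (∑ₙ-+ (suc k) (λ i → ℕ→ℚ (k C i) * h (suc i)) (λ i → ℕ→ℚ (k C suc i) * h (suc i))) ⟩
  h₀ + (A + ∑ₙ (suc k) (λ i → ℕ→ℚ (k C suc i) * h (suc i)))
    ≡⟨ cong (λ z → h₀ + (A + z)) (∑ₙ-last k (λ i → ℕ→ℚ (k C suc i) * h (suc i))) ⟩
  h₀ + (A + (B + ℕ→ℚ (k C suc k) * h (suc k)))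
    ≡⟨ cong (λ z → h₀ + (A + (B + ℕ→ℚ z * h (suc k)))) (k>n⇒nCk≡0 (ℕP.n<1+n k)) ⟩
  h₀ + (A + (B + 0ℚ * h (suc k)))
    ≡⟨ rearrange h₀ A B (h (suc k)) ⟩
  (h₀ + B) + A ∎
  where
  open ≡-Reasoning
  h₀ A B : ℚ
  h₀ = ℕ→ℚ 1 * h 0
  A = ∑ₙ (suc k) (λ i → ℕ→ℚ (k C i) * h (suc i))
  B = ∑ₙ k (λ i → ℕ→ℚ (k C suc i) * h (suc i))
  pascal-term : ∀ i → ℕ→ℚ (suc k C suc i) * h (suc i) ≡ ℕ→ℚ (k C i) * h (suc i) + ℕ→ℚ (k C suc i) * h (suc i)
  pascal-term i = trans (cong (λ z → ℕ→ℚ z * h (suc i)) (sym (nCk+nC[k+1]≡[n+1]C[k+1] k i)))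
                        (trans (cong (_* h (suc i)) (ℕ→ℚ-+ (k C i) (k C suc i)))
                               (ℚP.*-distribʳ-+ (h (suc i)) (ℕ→ℚ (k C i)) (ℕ→ℚ (k C suc i))))
  rearrange : ∀ x a b z → x + (a + (b + 0ℚ * z)) ≡ (x + b) + a
  rearrange = solve 4 (λ x a b z → x :+ (a :+ (b :+ con 0ℚ :* z)) := (x :+ b) :+ a) refl
    where open ℚSolver.+-*-Solver

-- Enlarging the upper corner in direction j (Pascal's rule in that coordinate).
binomialSum-inc-upper : ∀ {p} (j : Fin p) (b a : Vec ℕ p) → lookup b j ≤ lookup a j → (g : Vec ℕ p → ℚ) →
  binomialSum b (inc j a) g ≡ binomialSum b a g + binomialSum b a (g ∘ inc j)
binomialSum-inc-upper Fin.zero (b ∷ bs) (a ∷ as) b≤a g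
  rewrite ℕP.+-∸-assoc 1 (ℕP.m≤n⇒m≤1+n b≤a) | ℕP.+-∸-assoc 1 b≤a =
  trans (pascal-sum (a ∸ b) (λ i → binomialSum bs as (λ cs → g ((b ℕ.+ i) ∷ cs))))
        (cong (_+_ (∑ₙ (suc (a ∸ b)) (λ i → ℕ→ℚ ((a ∸ b) C i) * binomialSum bs as (λ cs → g ((b ℕ.+ i) ∷ cs)))))
              (∑ₙ-cong (suc (a ∸ b)) (λ i →
           cong (ℕ→ℚ ((a ∸ b) C i) *_) (binomialSum-cong bs as (λ cs → cong (λ z → g (z ∷ cs)) (ℕP.+-suc b i))))))
binomialSum-inc-upper (Fin.suc j) (b ∷ bs) (a ∷ as) b≤a g =
  trans (∑ₙ-cong (suc a ∸ b) (λ i →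
          trans (cong (ℕ→ℚ ((a ∸ b) C i) *_) (binomialSum-inc-upper j bs as b≤a (λ cs → g ((b ℕ.+ i) ∷ cs))))
                (ℚP.*-distribˡ-+ (ℕ→ℚ ((a ∸ b) C i)) _ _)))
        (∑ₙ-+ (suc a ∸ b) (λ i → ℕ→ℚ ((a ∸ b) C i) * binomialSum bs as (λ cs → g ((b ℕ.+ i) ∷ cs)))
                          (λ i → ℕ→ℚ ((a ∸ b) C i) * binomialSum bs as (λ cs → g ((b ℕ.+ i) ∷ inc j cs))))

∩-mono : ∀ {n} (E F : Subset n) → E ⊑ F → ∀ A → ∣ E ∩ A ∣ ≤ ∣ F ∩ A ∣
∩-mono []          []          _  []          = z≤n
∩-mono (true  ∷ E) (true  ∷ F) le (true  ∷ A) = s≤s (∩-mono E F le A)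
∩-mono (true  ∷ E) (true  ∷ F) le (false ∷ A) = ∩-mono E F le A
∩-mono (true  ∷ E) (false ∷ F) () A
∩-mono (false ∷ E) (false ∷ F) le (_     ∷ A) = ∩-mono E F le A
∩-mono (false ∷ E) (true  ∷ F) le (true  ∷ A) = ℕP.m≤n⇒m≤1+n (∩-mono E F le A)
∩-mono (false ∷ E) (true  ∷ F) le (false ∷ A) = ∩-mono E F le A

profile-mono : ∀ {n p} (part : Fin n → Fin p) (E F : Subset n) → E ⊑ F → ∀ j →
               lookup (profile part E) j ≤ lookup (profile part F) j
profile-mono part E F le j
  rewrite VecP.lookup∘tabulate (λ i → ∣ E ∩ block part i ∣) j
        | VecP.lookup∘tabulate (λ i → ∣ F ∩ block part i ∣) j = ∩-mono E F le (block part j)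

profile-sum : ∀ {n p} (part : Fin n → Fin p) (E F : Subset n) → E ⊑ F → (g : Vec ℕ p → ℚ) →
              ∑ E F (g ∘ profile part) ≡ binomialSum (profile part E) (profile part F) g
profile-sum {zero}  part []          []          _  g = sym (binomialSum-point (profile part []) g)
profile-sum {suc n} part (true  ∷ E) (false ∷ F) () g
profile-sum {suc n} part (false ∷ E) (false ∷ F) le g = profile-sum (part ∘ Fin.suc) E F le g
profile-sum {suc n} part (true  ∷ E) (true  ∷ F) le g = begin
  ∑ E F (λ S → g (profile part (true ∷ S)))
    ≡⟨ ∑-cong E F (λ S _ _ → cong g (profile-inside part S)) ⟩
  ∑ E F (λ S → g (inc j (profile part′ S)))
    ≡⟨ profile-sum part′ E F le (g ∘ inc j) ⟩
  binomialSum (profile part′ E) (profile part′ F) (g ∘ inc j)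
    ≡⟨ sym (binomialSum-inc j (profile part′ E) (profile part′ F) g) ⟩
  binomialSum (inc j (profile part′ E)) (inc j (profile part′ F)) g
    ≡⟨ sym (cong₂ (λ u v → binomialSum u v g) (profile-inside part E) (profile-inside part F)) ⟩
  binomialSum (profile part (true ∷ E)) (profile part (true ∷ F)) g ∎
  where
  open ≡-Reasoning
  j : Fin _
  j = part Fin.zero
  part′ : Fin n → Fin _
  part′ = part ∘ Fin.suc
profile-sum {suc n} part (false ∷ E) (true ∷ F) le g = begin
  ∑ E F (g ∘ profile part′) + ∑ E F (λ S → g (profile part (true ∷ S)))
    ≡⟨ cong₂ _+_ (profile-sum part′ E F le g)
                 (trans (∑-cong E F (λ S _ _ → cong g (profile-inside part S)))
                        (profile-sum part′ E F le (g ∘ inc j))) ⟩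
  binomialSum (profile part′ E) (profile part′ F) g + binomialSum (profile part′ E) (profile part′ F) (g ∘ inc j)
    ≡⟨ sym (binomialSum-inc-upper j (profile part′ E) (profile part′ F) (profile-mono part′ E F le j) g) ⟩
  binomialSum (profile part′ E) (inc j (profile part′ F)) g
    ≡⟨ cong (λ v → binomialSum (profile part′ E) v g) (sym (profile-inside part F)) ⟩
  binomialSum (profile part (false ∷ E)) (profile part (true ∷ F)) g ∎
  where
  open ≡-Reasoning
  j : Fin _
  j = part Fin.zero
  part′ : Fin n → Fin _
  part′ = part ∘ Fin.suc

-- The one-block case of the counting lemma: sums of functions of the cardinality.
card-sum : ∀ {n} (E F : Subset n) → E ⊑ F → (g : ℕ → ℚ) →
  ∑ E F (g ∘ ∣_∣) ≡ ∑ₙ (suc ∣ F ∣ ∸ ∣ E ∣) (λ j → ℕ→ℚ ((∣ F ∣ ∸ ∣ E ∣) C j) * g (∣ E ∣ ℕ.+ j))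
card-sum {n} E F E⊑F g = begin
  ∑ E F (g ∘ ∣_∣)                              ≡⟨ ∑-cong E F (λ X _ _ → cong (g ∘ Vec.head) (sym (profile-one X))) ⟩
  ∑ E F (g ∘ Vec.head ∘ profile one)           ≡⟨ profile-sum one E F E⊑F (g ∘ Vec.head) ⟩
  binomialSum (profile one E) (profile one F) (g ∘ Vec.head)
    ≡⟨ cong₂ (λ u v → binomialSum u v (g ∘ Vec.head)) (profile-one E) (profile-one F) ⟩
  binomialSum (∣ E ∣ ∷ []) (∣ F ∣ ∷ []) (g ∘ Vec.head) ∎
  where
  open ≡-Reasoning
  one : Fin n → Fin 1
  one _ = Fin.zero
  ∩-full : ∀ {m} (X : Subset m) → ∣ X ∩ tabulate (λ _ → true) ∣ ≡ ∣ X ∣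
  ∩-full []          = refl
  ∩-full (true  ∷ X) = cong suc (∩-full X)
  ∩-full (false ∷ X) = ∩-full X
  profile-one : ∀ X → profile one X ≡ ∣ X ∣ ∷ []
  profile-one X = cong (_∷ []) (∩-full X)

shapleyWeight-interval : ∀ {n} (B T : Subset n) → T ⊑ ∁ B →
  ∑ T (∁ B) (λ X → shapleyWeight n ∣ B ∣ ∣ X ∣) ≡ (+ 1) / suc ∣ T ∣
shapleyWeight-interval {n} B T T⊑∁B =
  trans (card-sum T (∁ B) T⊑∁B (shapleyWeight n ∣ B ∣))
        (shapleyWeight-sum n (∣ B ∣) (∣ T ∣) (∣ ∁ B ∣) (SubsetP.∣∁p∣≡n∸∣p∣ B) (⊑-card T (∁ B) T⊑∁B))

alternating-sum : ∀ {n} (μ : Subset n → ℚ) (A X : Subset n) → X ⊑ ∁ A →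
  sumℚ (map (λ U → neg1^ (∣ A ∣ ∸ ∣ U ∣) * μ (X ∪ U)) (subsetsOf A)) ≡ ∑ ⊥ X (λ T → mobius μ (A ∪ T))
alternating-sum μ A X X⊑∁A = begin
  sumℚ (map (λ U → neg1^ (∣ A ∣ ∸ ∣ U ∣) * μ (X ∪ U)) (subsetsOf A))
    ≡⟨ sumℚ-subsetsOf A (λ U → neg1^ (∣ A ∣ ∸ ∣ U ∣) * μ (X ∪ U)) ⟩
  ∑ ⊥ A (λ U → neg1^ (∣ A ∣ ∸ ∣ U ∣) * μ (X ∪ U))
    ≡⟨ ∑-cong ⊥ A (λ U _ U⊑A → cong (λ k → neg1^ k * μ (X ∪ U)) (sym (card-difference U A U⊑A))) ⟩
  Δ μ A X
    ≡⟨ Δ-mobius μ A X X⊑∁A ⟩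
  ∑ ⊥ X (λ T → mobiusᴵ μ (A ∪ T))
    ≡⟨ ∑-cong ⊥ X (λ T _ _ → sym (mobius≡mobiusᴵ μ (A ∪ T))) ⟩
  ∑ ⊥ X (λ T → mobius μ (A ∪ T)) ∎
  where open ≡-Reasoning

shapley-mobius : ∀ {n} (μ : Subset n → ℚ) (A : Subset n) →
  shapleyInteraction μ A ≡ ∑ ⊥ (∁ A) (λ T → (+ 1) / suc ∣ T ∣ * mobius μ (A ∪ T))
shapley-mobius {n} μ A = begin
  shapleyInteraction μ A
    ≡⟨ sumℚ-subsetsOf (∁ A) _ ⟩
  ∑ ⊥ (∁ A) (λ X → w X * sumℚ (map (λ U → neg1^ (∣ A ∣ ∸ ∣ U ∣) * μ (X ∪ U)) (subsetsOf A)))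
    ≡⟨ ∑-cong ⊥ (∁ A) (λ X _ X⊑∁A → trans (cong (w X *_) (alternating-sum μ A X X⊑∁A))
                                            (sym (∑-*ˡ ⊥ X (w X) (λ T → m (A ∪ T))))) ⟩
  ∑ ⊥ (∁ A) (λ X → ∑ ⊥ X (λ T → w X * m (A ∪ T)))
    ≡⟨ ∑-swap ⊥ (∁ A) (λ X T → w X * m (A ∪ T)) ⟩
  ∑ ⊥ (∁ A) (λ T → ∑ T (∁ A) (λ X → w X * m (A ∪ T)))
    ≡⟨ ∑-cong ⊥ (∁ A) (λ T _ T⊑∁A → trans (∑-*ʳ T (∁ A) (m (A ∪ T)) w)
                                            (cong (_* m (A ∪ T)) (shapleyWeight-interval A T T⊑∁A))) ⟩
  ∑ ⊥ (∁ A) (λ T → (+ 1) / suc ∣ T ∣ * m (A ∪ T)) ∎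
  where
  open ≡-Reasoning
  w : Subset n → ℚ
  w X = shapleyWeight n ∣ A ∣ ∣ X ∣
  m : Subset n → ℚ
  m = mobius μ

box-binomialSum : ∀ {p} (b a : Vec ℕ p) (g : Vec ℕ p → ℚ) →
  sumℚ (map (λ c → ℕ→ℚ (binomProd a b c) * g c) (box b a)) ≡ binomialSum b a g
box-binomialSum []       []       g = trans (ℚP.+-identityʳ _) (ℚP.*-identityˡ (g []))
box-binomialSum (b ∷ bs) (a ∷ as) g = begin
  sumℚ (map term (concatMap (λ c → map (c ∷_) (box bs as)) (range b a)))
    ≡⟨ sumℚ-concatMap (range b a) (λ c → map (c ∷_) (box bs as)) term ⟩
  sumℚ (map (λ c → sumℚ (map term (map (c ∷_) (box bs as)))) (range b a))
    ≡⟨ sumℚ-map-cong (range b a) slice ⟩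
  sumℚ (map sliceSum (range b a))
    ≡⟨ cong sumℚ (sym (ListP.map-∘ (upTo (suc a ∸ b)))) ⟩
  sumℚ (map (sliceSum ∘ (b ℕ.+_)) (upTo (suc a ∸ b)))
    ≡⟨ sumℚ-applyUpTo (sliceSum ∘ (b ℕ.+_)) (λ j → j) (suc a ∸ b) ⟩
  ∑ₙ (suc a ∸ b) (sliceSum ∘ (b ℕ.+_))
    ≡⟨ ∑ₙ-cong (suc a ∸ b) (λ j → cong (λ z → ℕ→ℚ ((a ∸ b) C z) * binomialSum bs as (λ cs → g ((b ℕ.+ j) ∷ cs)))
                                      (ℕP.m+n∸m≡n b j)) ⟩
  binomialSum (b ∷ bs) (a ∷ as) g ∎
  where
  open ≡-Reasoning
  term : Vec ℕ _ → ℚ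
  term c = ℕ→ℚ (binomProd (a ∷ as) (b ∷ bs) c) * g c
  sliceSum : ℕ → ℚ
  sliceSum c = ℕ→ℚ ((a ∸ b) C (c ∸ b)) * binomialSum bs as (λ cs → g (c ∷ cs))
  slice : ∀ c → sumℚ (map term (map (c ∷_) (box bs as))) ≡ sliceSum c
  slice c = begin
    sumℚ (map term (map (c ∷_) (box bs as)))
      ≡⟨ cong sumℚ (sym (ListP.map-∘ (box bs as))) ⟩
    sumℚ (map (λ cs → term (c ∷ cs)) (box bs as))
      ≡⟨ sumℚ-map-cong (box bs as) (λ cs →
           trans (cong (_* g (c ∷ cs)) (ℕ→ℚ-* ((a ∸ b) C (c ∸ b)) (binomProd as bs cs)))
                 (ℚP.*-assoc (ℕ→ℚ ((a ∸ b) C (c ∸ b))) (ℕ→ℚ (binomProd as bs cs)) (g (c ∷ cs)))) ⟩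
    sumℚ (map (λ cs → ℕ→ℚ ((a ∸ b) C (c ∸ b)) * (ℕ→ℚ (binomProd as bs cs) * g (c ∷ cs))) (box bs as))
      ≡⟨ sumℚ-map-*ˡ (box bs as) (ℕ→ℚ ((a ∸ b) C (c ∸ b))) (λ cs → ℕ→ℚ (binomProd as bs cs) * g (c ∷ cs)) ⟩
    ℕ→ℚ ((a ∸ b) C (c ∸ b)) * sumℚ (map (λ cs → ℕ→ℚ (binomProd as bs cs) * g (c ∷ cs)) (box bs as))
      ≡⟨ cong (ℕ→ℚ ((a ∸ b) C (c ∸ b)) *_) (box-binomialSum bs as (λ cs → g (c ∷ cs))) ⟩
    sliceSum c ∎

box⁺ : ∀ {p} (lo c hi : Vec ℕ p) → (∀ i → lookup lo i ≤ lookup c i) → (∀ i → lookup c i ≤ lookup hi i) →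
       c ∈ box lo hi
box⁺ []       []       []       _     _     = here refl
box⁺ (l ∷ ls) (x ∷ cs) (h ∷ hs) lo≤c c≤hi =
  MembershipP.∈-concat⁺′ (MembershipP.∈-map⁺ (x ∷_) (box⁺ ls cs hs (lo≤c ∘ Fin.suc) (c≤hi ∘ Fin.suc)))
                         (MembershipP.∈-map⁺ (λ c → map (c ∷_) (box ls hs)) x∈range)
  where
  l≤x : l ≤ x
  l≤x = lo≤c Fin.zero
  x≤h : x ≤ h
  x≤h = c≤hi Fin.zero
  offset< : x ∸ l < suc h ∸ l
  offset< = subst (x ∸ l <_) (sym (ℕP.+-∸-assoc 1 (ℕP.≤-trans l≤x x≤h))) (s≤s (ℕP.∸-monoˡ-≤ l x≤h))
  x∈range : x ∈ range l h
  x∈range = subst (_∈ range l h) (ℕP.m+[n∸m]≡n l≤x) (MembershipP.∈-map⁺ (l ℕ.+_) (MembershipP.∈-upTo⁺ offset<))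

profile∈box : ∀ {n p} (part : Fin n → Fin p) (T : Subset n) →
              profile part T ∈ box (Vec.replicate p 0) (blockSizes part)
profile∈box {p = p} part T = box⁺ (Vec.replicate p 0) (profile part T) (blockSizes part)
  (λ i → subst (_≤ lookup (profile part T) i) (sym (VecP.lookup-replicate i 0)) z≤n)
  (λ i → subst₂ _≤_ (sym (VecP.lookup∘tabulate (λ i → ∣ T ∩ block part i ∣) i))
                     (sym (VecP.lookup∘tabulate (λ i → ∣ block part i ∣) i))
                     (SubsetP.∣p∩q∣≤∣q∣ T (block part i)))

profile-⊤ : ∀ {n p} (part : Fin n → Fin p) → profile part ⊤ ≡ blockSizes part
profile-⊤ part = VecP.tabulate-cong (λ i → cong ∣_∣ (SubsetP.∩-identityˡ (block part i)))

sumVec-inc : ∀ {p} (j : Fin p) (v : Vec ℕ p) → sumVec (inc j v) ≡ suc (sumVec v)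
sumVec-inc Fin.zero    (x ∷ v) = refl
sumVec-inc (Fin.suc j) (x ∷ v) = trans (cong (x ℕ.+_) (sumVec-inc j v)) (ℕP.+-suc x (sumVec v))

sumVec-profile : ∀ {n p} (part : Fin n → Fin p) (D : Subset n) → sumVec (profile part D) ≡ ∣ D ∣
sumVec-profile {zero}  {p} part []          = zeros p
  where
  zeros : ∀ q → sumVec (tabulate {n = q} (λ _ → 0)) ≡ 0
  zeros zero    = refl
  zeros (suc q) = zeros q
sumVec-profile {suc n} part (false ∷ D) = sumVec-profile (part ∘ Fin.suc) D
sumVec-profile {suc n} part (true  ∷ D) =
  trans (cong sumVec (profile-inside part D))
        (trans (sumVec-inc (part Fin.zero) (profile (part ∘ Fin.suc) D))
               (cong suc (sumVec-profile (part ∘ Fin.suc) D)))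

subset-ext : ∀ {n} {X Y : Subset n} → (∀ x → lookup X x ≡ lookup Y x) → X ≡ Y
subset-ext {X = X} {Y} eq =
  trans (sym (VecP.tabulate∘lookup X)) (trans (VecP.tabulate-cong eq) (VecP.tabulate∘lookup Y))

split : ∀ {n} (X A : Subset n) → X ≡ (X ∩ A) ∪ (X ∩ ∁ A)
split X A = trans (sym (SubsetP.∩-identityʳ X))
                  (trans (cong (X ∩_) (sym (SubsetP.p∪∁p≡⊤ A))) (SubsetP.∩-distribˡ-∪ X A (∁ A)))

indifference-swap : ∀ {n} {μ : Subset n → ℚ} {A X Y : Subset n} → IsIndifference μ A →
                    X ∩ ∁ A ≡ Y ∩ ∁ A → ∣ X ∩ A ∣ ≡ ∣ Y ∩ A ∣ → μ X ≡ μ Y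
indifference-swap {μ = μ} {A} {X} {Y} indifferent same-outside same-count = begin
  μ X                       ≡⟨ cong μ (split X A) ⟩
  μ ((X ∩ A) ∪ (X ∩ ∁ A))   ≡⟨ indifferent (X ∩ A) (Y ∩ A) (X ∩ ∁ A) (SubsetP.p∩q⊆q X A) (SubsetP.p∩q⊆q Y A)
                                           same-count (SubsetP.p∩q⊆q X (∁ A)) ⟩
  μ ((Y ∩ A) ∪ (X ∩ ∁ A))   ≡⟨ cong (λ Z → μ ((Y ∩ A) ∪ Z)) same-outside ⟩
  μ ((Y ∩ A) ∪ (Y ∩ ∁ A))   ≡⟨ cong μ (sym (split Y A)) ⟩
  μ Y                       ∎
  where open ≡-Reasoning

-- Interpolating between two sets T and T′ block by block: mix s agrees with
-- T′ on the blocks selected by s and with T on the others.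
module Interpolation {n p : ℕ} (part : Fin n → Fin p) (T T′ : Subset n) where

  open DecMembership (Fin._≟_ {p}) using (_∈?_)

  mix : (Fin p → Bool) → Subset n
  mix s = tabulate (λ x → if s (part x) then lookup T′ x else lookup T x)

  select : Fin p → (Fin p → Bool) → Fin p → Bool
  select j s i = does (i Fin.≟ j) ∨ s i

  lookup-∩ : ∀ (X Y : Subset n) x → lookup (X ∩ Y) x ≡ lookup X x ∧ lookup Y x
  lookup-∩ X Y x = VecP.lookup-zipWith _∧_ x X Y

  mix-outside : ∀ j s → mix s ∩ ∁ (block part j) ≡ mix (select j s) ∩ ∁ (block part j)
  mix-outside j s = subset-ext λ x → begin
    lookup (mix s ∩ ∁ (block part j)) x
      ≡⟨ trans (lookup-∩ (mix s) _ x) (cong₂ _∧_ (VecP.lookup∘tabulate _ x)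
                 (trans (VecP.lookup-map x not (block part j)) (cong not (VecP.lookup∘tabulate _ x)))) ⟩
    (if s (part x) then lookup T′ x else lookup T x) ∧ not (does (part x Fin.≟ j))
      ≡⟨ unselected (does (part x Fin.≟ j)) (s (part x)) (lookup T′ x) (lookup T x) ⟩
    (if select j s (part x) then lookup T′ x else lookup T x) ∧ not (does (part x Fin.≟ j))
      ≡⟨ sym (trans (lookup-∩ (mix (select j s)) _ x) (cong₂ _∧_ (VecP.lookup∘tabulate _ x)
                 (trans (VecP.lookup-map x not (block part j)) (cong not (VecP.lookup∘tabulate _ x))))) ⟩
    lookup (mix (select j s) ∩ ∁ (block part j)) x ∎
    where
    open ≡-Reasoning
    unselected : ∀ d b (u v : Bool) → (if b then u else v) ∧ not d ≡ (if d ∨ b then u else v) ∧ not d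
    unselected true  b u v = trans (BoolP.∧-zeroʳ _) (sym (BoolP.∧-zeroʳ _))
    unselected false b u v = refl

  mix-inside : ∀ j s → mix s ∩ block part j ≡ (if s j then T′ else T) ∩ block part j
  mix-inside j s = subset-ext pointwise
    where
    lookup-if : ∀ b x → lookup (if b then T′ else T) x ≡ (if b then lookup T′ x else lookup T x)
    lookup-if true  x = refl
    lookup-if false x = refl
    pointwise : ∀ x → lookup (mix s ∩ block part j) x ≡ lookup ((if s j then T′ else T) ∩ block part j) x
    pointwise x
      rewrite lookup-∩ (mix s) (block part j) x | lookup-∩ (if s j then T′ else T) (block part j) x
            | VecP.lookup∘tabulate (λ y → if s (part y) then lookup T′ y else lookup T y) x
            | VecP.lookup∘tabulate (λ y → does (part y Fin.≟ j)) x
            | lookup-if (s j) x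
      with part x Fin.≟ j
    ... | yes refl = refl
    ... | no  _    = trans (BoolP.∧-zeroʳ _) (sym (BoolP.∧-zeroʳ _))

  mix-none : mix (λ _ → false) ≡ T
  mix-none = subset-ext (VecP.lookup∘tabulate _)

  mix-all : mix (λ i → does (i ∈? List.allFin p)) ≡ T′
  mix-all = subset-ext λ x → trans (VecP.lookup∘tabulate _ x)
    (cong (λ b → if b then lookup T′ x else lookup T x) (dec-true (part x ∈? List.allFin p) (MembershipP.∈-allFin (part x))))

  module _ {μ : Subset n → ℚ} (indifferent : AllIndifference μ part)
           (same-profile : profile part T ≡ profile part T′) where

    same-count : ∀ j → ∣ T ∩ block part j ∣ ≡ ∣ T′ ∩ block part j ∣
    same-count j = trans (sym (VecP.lookup∘tabulate (λ i → ∣ T ∩ block part i ∣) j))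
                         (trans (cong (λ v → lookup v j) same-profile) (VecP.lookup∘tabulate (λ i → ∣ T′ ∩ block part i ∣) j))

    mix-count : ∀ j s → ∣ mix s ∩ block part j ∣ ≡ ∣ T ∩ block part j ∣
    mix-count j s = trans (cong ∣_∣ (mix-inside j s)) (chosen (s j))
      where
      chosen : ∀ b → ∣ (if b then T′ else T) ∩ block part j ∣ ≡ ∣ T ∩ block part j ∣
      chosen true  = sym (same-count j)
      chosen false = refl

    mix-select : ∀ j s → μ (mix s) ≡ μ (mix (select j s))
    mix-select j s = indifference-swap {μ = μ} (indifferent j) (mix-outside j s)
                                       (trans (mix-count j s) (sym (mix-count j (select j s))))

    mix-list : ∀ js → μ T ≡ μ (mix (λ i → does (i ∈? js)))
    mix-list []       = cong μ (sym mix-none)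
    mix-list (j ∷ js) = trans (mix-list js) (mix-select j (λ i → does (i ∈? js)))

profile-invariance : ∀ {n p} {μ : Subset n → ℚ} (part : Fin n → Fin p) → AllIndifference μ part →
                     ∀ T T′ → profile part T ≡ profile part T′ → μ T ≡ μ T′
profile-invariance {p = p} {μ} part indifferent T T′ same-profile =
  trans (Interpolation.mix-list part T T′ indifferent same-profile (List.allFin p))
        (cong μ (Interpolation.mix-all part T T′))

-- If μ factors through the profile, so does its Möbius transform:
--   m(D) = Σ_{c ≤ d} Π_k C(d_k, c_k) (-1)^{|d|-|c|} φ(c)  for d the profile of D.
mobius-factors : ∀ {n p} (part : Fin n → Fin p) (μ : Subset n → ℚ) (φ : Vec ℕ p → ℚ) →
                 (∀ U → μ U ≡ φ (profile part U)) →
                 ∀ D D′ → profile part D ≡ profile part D′ → mobius μ D ≡ mobius μ D′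
mobius-factors part μ φ μ≡φ D D′ same-profile =
  trans (mobius-profile D) (trans (cong Φ same-profile) (sym (mobius-profile D′)))
  where
  Φ : Vec ℕ _ → ℚ
  Φ d = binomialSum (profile part ⊥) d (λ c → neg1^ (sumVec d ∸ sumVec c) * φ c)
  mobius-profile : ∀ D → mobius μ D ≡ Φ (profile part D)
  mobius-profile D = begin
    mobius μ D
      ≡⟨ mobius≡mobiusᴵ μ D ⟩
    ∑ ⊥ D (λ U → neg1^ ∣ D ∩ ∁ U ∣ * μ U)
      ≡⟨ ∑-cong ⊥ D (λ U _ U⊑D → cong₂ _*_ (cong neg1^ (trans (card-difference U D U⊑D)
                                              (sym (cong₂ _∸_ (sumVec-profile part D) (sumVec-profile part U)))))
                                            (μ≡φ U)) ⟩
    ∑ ⊥ D (λ U → neg1^ (sumVec (profile part D) ∸ sumVec (profile part U)) * φ (profile part U))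
      ≡⟨ profile-sum part ⊥ D (⊥⊑ D) (λ c → neg1^ (sumVec (profile part D) ∸ sumVec c) * φ c) ⟩
    Φ (profile part D) ∎
    where open ≡-Reasoning

mobius-representative : ∀ {n p} (μ : Subset n → ℚ) (part : Fin n → Fin p) → AllIndifference μ part →
  (rep : Vec ℕ p → Subset n) →
  (∀ c → c ∈ box (Vec.replicate p 0) (blockSizes part) → profile part (rep c) ≡ c) →
  ∀ D → mobius μ D ≡ mobius μ (rep (profile part D))
mobius-representative μ part indifferent rep rep-profile D =
  mobius-factors part μ (μ ∘ rep) μ-factors D (rep (profile part D)) (represents D)
  where
  represents : ∀ U → profile part U ≡ profile part (rep (profile part U))
  represents U = sym (rep-profile (profile part U) (profile∈box part U))
  μ-factors : ∀ U → μ U ≡ μ (rep (profile part U))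
  μ-factors U = profile-invariance part indifferent U (rep (profile part U)) (represents U)

profile-gap : ∀ {n p} (part : Fin n → Fin p) (B T : Subset n) → T ⊑ ∁ B →
              ∣ T ∣ ≡ sumVec (profile part (B ∪ T)) ∸ sumVec (profile part B)
profile-gap part B T T⊑∁B =
  sym (trans (cong₂ _∸_ (trans (sumVec-profile part (B ∪ T)) (card-∪-disjoint B T T⊑∁B)) (sumVec-profile part B))
             (ℕP.m+n∸m≡n ∣ B ∣ ∣ T ∣))

proposition4p3 : (n p : ℕ) (μ : Subset n → ℚ) (part : Fin n → Fin p) →
    IsFuzzyMeasure μ → IsPSymmetric μ part →
    (rep : Vec ℕ p → Subset n) →
    (∀ (c : Vec ℕ p) → c ∈ box (Data.Vec.replicate p 0) (blockSizes part) → profile part (rep c) ≡ c) →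
    (B : Subset n) →
    shapleyInteraction μ B
      ≡ propRHS (blockSizes part) (profile part B) (λ c → mobius μ (rep c))
proposition4p3 n p μ part _ (_ , indifferent , _) rep rep-profile B = begin
  shapleyInteraction μ B
    ≡⟨ shapley-mobius μ B ⟩
  ∑ ⊥ (∁ B) (λ T → (+ 1) / suc ∣ T ∣ * mobius μ (B ∪ T))
    ≡⟨ ∑-cong ⊥ (∁ B) (λ T _ T⊑∁B → cong₂ (λ k x → (+ 1) / suc k * x)
                         (profile-gap part B T T⊑∁B) (mobius-representative μ part indifferent rep rep-profile (B ∪ T))) ⟩
  ∑ ⊥ (∁ B) (λ T → g (profile part (B ∪ T)))   ≡⟨ ∑-translate B (g ∘ profile part) ⟩
  ∑ B ⊤ (g ∘ profile part)                     ≡⟨ profile-sum part B ⊤ (⊑⊤ B) g ⟩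
  binomialSum b (profile part ⊤) g             ≡⟨ cong (λ v → binomialSum b v g) (profile-⊤ part) ⟩
  binomialSum b a g                            ≡⟨ sym (box-binomialSum b a g) ⟩
  sumℚ (map (λ c → ℕ→ℚ (binomProd a b c) * g c) (box b a))
    ≡⟨ sumℚ-map-cong (box b a) (λ c → reorder (ℕ→ℚ (binomProd a b c)) ((+ 1) / suc (sumVec c ∸ sumVec b)) (mobius μ (rep c))) ⟩
  propRHS a b (λ c → mobius μ (rep c)) ∎
  where
  open ≡-Reasoning
  a b : Vec ℕ p
  a = blockSizes part
  b = profile part B
  g : Vec ℕ p → ℚ
  g c = (+ 1) / suc (sumVec c ∸ sumVec b) * mobius μ (rep c)
  reorder : ∀ x y z → x * (y * z) ≡ y * x * z
  reorder = solve 3 (λ x y z → x :* (y :* z) := y :* x :* z) refl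
    where open ℚSolver.+-*-Solver
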